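{- Let $N\ge1$ and let $f$ be a non-CM normalized cuspidal Hecke eigenform of weight $k\ge2$ for $\Gamma_0(N)$ with integer Fourier coefficients $a_f(m)$, $m\ge 1$. Let $n\ge1$ be a natural number and $p\nmid N$ a prime. Then for every positive divisor $d$ of $n+1$, $$P\big(a_f(p^n)\big)\;\ge\;P\big(a_f(p^{d-1})\big),$$ provided $a_f(p^n)\neq0$.
   Context: For an integer $m$, $P(m)$ denotes the largest prime factor of $m$, with the convention $P(0)=P(1)=P(-1)=1$. -}

module Defs where

open import Data.Nat using (ℕ; zero; suc)
open import Data.Nat.Divisibility using (_∣_; _∣?_)
open import Data.Nat.Primality using (Prime; prime?)
open import Data.Integer as ℤ using (ℤ; ∣_∣)
open import Relation.Nullary using (yes; no)

lpfUpTo : ℕ → ℕ → ℕ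
lpfUpTo n zero = 1
lpfUpTo n (suc q) with prime? (suc q) | suc q ∣? n
... | yes _ | yes _ = suc q
... | _     | _     = lpfUpTo n q

-- P m : the largest prime factor of the integer m, with P(0) = P(1) = P(-1) = 1.
P : ℤ → ℕ
P m with ∣ m ∣
... | zero  = 1
... | suc j = lpfUpTo (suc j) (suc j)

{-# OPTIONS --safe #-}
-- With U 0 = 0 and U (m + 1) = a_f(p^m), the Hecke recurrence
-- a_f(p^(m+2)) = a_f(p) a_f(p^(m+1)) - p^(k-1) a_f(p^m) makes U a Lucas sequence,
-- and Lucas sequences are divisibility sequences by the addition formula
-- U (m + n + 1) = U (m + 1) U (n + 1) - p^(k-1) U m U n.  Hence d ∣ n + 1 gives
-- a_f(p^(d-1)) ∣ a_f(p^n), and the largest prime factor is monotone under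
-- divisibility of nonzero integers.
module Submission where

open import Defs
open import Data.Nat as ℕ using (ℕ; suc; _≥_; _^_; _∸_)
open import Data.Nat.Divisibility using (_∣_)
open import Data.Nat.Primality using (Prime)
open import Data.Integer as ℤ using (ℤ; +_)
open import Relation.Binary.PropositionalEquality using (_≡_; _≢_)
open import Relation.Nullary using (¬_)

open import Data.Nat using (zero; _≤_; _<_; ≢-nonZero; >-nonZero⁻¹)
open import Data.Nat.Properties using (≤-reflexive; ≤-trans; ≤-pred; m≤n⇒m<n∨m≡n; +-suc; +-identityʳ)
open import Data.Nat.Divisibility using (_∣?_; divides-refl; ∣-trans; ∣⇒≤; 0∣⇒≡0)
open import Data.Nat.Primality using (prime?; prime⇒nonZero; ¬prime[0])
open import Data.Integer using (∣_∣; _*_; _-_)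
open import Data.Integer.Properties using (∣i∣≡0⇒i≡0; *-zeroˡ)
import Data.Integer.Divisibility as ℤᵤ
open import Data.Integer.Divisibility.Signed as ℤˢ
  using (divides; ∣⇒∣ᵤ; ∣m⇒∣m*n; ∣n⇒∣m*n; ∣m∣n⇒∣m-n)
  renaming (∣-refl to ∣ˢ-refl; ∣-trans to ∣ˢ-trans; ∣-reflexive to ∣ˢ-reflexive)
open import Data.Integer.Tactic.RingSolver using (solve-∀)
open import Data.Product using (_×_; _,_)
open import Data.Sum using (_⊎_; inj₁; inj₂)
open import Function using (_∘_)
open import Relation.Nullary using (yes; no; contradiction)
open import Relation.Binary.PropositionalEquality using (refl; sym; trans; cong; subst₂; module ≡-Reasoning)

lpfUpTo≡1⊎prime∣ : ∀ n q → lpfUpTo n q ≡ 1 ⊎ (Prime (lpfUpTo n q) × lpfUpTo n q ∣ n)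
lpfUpTo≡1⊎prime∣ n zero = inj₁ refl
lpfUpTo≡1⊎prime∣ n (suc q) with prime? (suc q) | suc q ∣? n
... | yes p | yes q∣n = inj₂ (p , q∣n)
... | yes _ | no _    = lpfUpTo≡1⊎prime∣ n q
... | no _  | _       = lpfUpTo≡1⊎prime∣ n q

0<lpfUpTo : ∀ n q → 0 < lpfUpTo n q
0<lpfUpTo n q with lpfUpTo≡1⊎prime∣ n q
... | inj₁ ≡1      = ≤-reflexive (sym ≡1)
... | inj₂ (p , _) = >-nonZero⁻¹ _ {{prime⇒nonZero p}}

lpfUpTo-maximal : ∀ {n r} q → Prime r → r ∣ n → r ≤ q → r ≤ lpfUpTo n q
lpfUpTo-maximal zero    r-prime _ ℕ.z≤n = contradiction r-prime ¬prime[0]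
lpfUpTo-maximal {n} (suc q) r-prime r∣n r≤1+q
  with prime? (suc q) | suc q ∣? n | m≤n⇒m<n∨m≡n r≤1+q
... | yes _   | yes _   | _         = r≤1+q
... | no ¬p   | _       | inj₂ refl = contradiction r-prime ¬p
... | yes _   | no ¬r∣n | inj₂ refl = contradiction r∣n ¬r∣n
... | no _    | _       | inj₁ r≤q  = lpfUpTo-maximal q r-prime r∣n (≤-pred r≤q)
... | yes _   | no _    | inj₁ r≤q  = lpfUpTo-maximal q r-prime r∣n (≤-pred r≤q)

lpfUpTo-mono-∣ : ∀ {m n} → m ∣ n → n ≢ 0 → lpfUpTo m m ≤ lpfUpTo n n
lpfUpTo-mono-∣ {m} {n} m∣n n≢0 with lpfUpTo≡1⊎prime∣ m m
... | inj₁ ≡1         = ≤-trans (≤-reflexive ≡1) (0<lpfUpTo n n)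
... | inj₂ (p , ℓ∣m) = lpfUpTo-maximal n p ℓ∣n (∣⇒≤ {{≢-nonZero n≢0}} ℓ∣n)
  where ℓ∣n = ∣-trans ℓ∣m m∣n

P≡lpfUpTo : ∀ m → P m ≡ lpfUpTo ∣ m ∣ ∣ m ∣
P≡lpfUpTo m with ∣ m ∣
... | zero  = refl
... | suc _ = refl

P-mono-∣ : ∀ x y → x ℤᵤ.∣ y → y ≢ + 0 → P x ≤ P y
P-mono-∣ x y x∣y y≢0 =
  subst₂ _≤_ (sym (P≡lpfUpTo x)) (sym (P≡lpfUpTo y)) (lpfUpTo-mono-∣ x∣y (y≢0 ∘ ∣i∣≡0⇒i≡0))

module LucasSequence (A B : ℤ) (U : ℕ → ℤ) (U-0 : U 0 ≡ + 0) (U-1 : U 1 ≡ + 1)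
  (U-rec : ∀ m → U (suc (suc m)) ≡ A * U (suc m) - B * U m) where

  U-+ : ∀ m n → U (suc m ℕ.+ n) ≡ U (suc m) * U (suc n) - B * U m * U n
  U-+ m zero rewrite +-identityʳ m | U-0 | U-1 = unit (U (suc m)) (B * U m)
    where
    unit : ∀ x y → x ≡ x * + 1 - y * + 0
    unit = solve-∀
  U-+ m (suc n) = begin
    U (suc (m ℕ.+ suc n))                                         ≡⟨ cong (U ∘ suc) (+-suc m n) ⟩
    U (suc (suc m) ℕ.+ n)                                         ≡⟨ U-+ (suc m) n ⟩
    U (suc (suc m)) * U (suc n) - B * U (suc m) * U n             ≡⟨ cong (λ t → t * U (suc n) - B * U (suc m) * U n) (U-rec m) ⟩
    (A * U (suc m) - B * U m) * U (suc n) - B * U (suc m) * U n   ≡⟨ regroup A B (U (suc m)) (U m) (U (suc n)) (U n) ⟩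
    U (suc m) * (A * U (suc n) - B * U n) - B * U m * U (suc n)   ≡⟨ cong (λ t → U (suc m) * t - B * U m * U (suc n)) (U-rec n) ⟨
    U (suc m) * U (suc (suc n)) - B * U m * U (suc n)             ∎
    where
    open ≡-Reasoning
    regroup : ∀ a b x y u v → (a * x - b * y) * u - b * x * v ≡ x * (a * u - b * v) - b * y * u
    regroup = solve-∀

  U-mono-∣ : ∀ {m n} → m ∣ n → U m ℤˢ.∣ U n
  U-mono-∣ {zero} 0∣n rewrite 0∣⇒≡0 0∣n = ∣ˢ-refl
  U-mono-∣ {suc e} (divides-refl q) = U[1+e]∣U[q*[1+e]] q
    where
    U[1+e]∣U[q*[1+e]] : ∀ q → U (suc e) ℤˢ.∣ U (q ℕ.* suc e)
    U[1+e]∣U[q*[1+e]] zero    = divides (+ 0) (trans U-0 (sym (*-zeroˡ (U (suc e)))))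
    U[1+e]∣U[q*[1+e]] (suc q) = ∣ˢ-trans
      (∣m∣n⇒∣m-n (∣m⇒∣m*n _ ∣ˢ-refl) (∣n⇒∣m*n (B * U e) (U[1+e]∣U[q*[1+e]] q)))
      (∣ˢ-reflexive (sym (U-+ e (q ℕ.* suc e))))

module _ (B : ℤ) (a : ℕ → ℤ) (a-0 : a 0 ≡ + 1)
  (a-rec : ∀ m → a (suc (suc m)) ≡ a 1 * a (suc m) - B * a m) where

  private
    U : ℕ → ℤ
    U zero    = + 0
    U (suc m) = a m

    U-rec : ∀ m → U (suc (suc m)) ≡ a 1 * U (suc m) - B * U m
    U-rec zero rewrite a-0 = unit (a 1) B
      where
      unit : ∀ x y → x ≡ x * + 1 - y * + 0
      unit = solve-∀
    U-rec (suc m) = a-rec m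

  shifted-mono-∣ : ∀ {m n} → suc m ∣ suc n → a m ℤˢ.∣ a n
  shifted-mono-∣ = LucasSequence.U-mono-∣ (a 1) B U refl a-0 U-rec

lemma4 : (N k p : ℕ) → N ≥ 1 → k ≥ 2 → Prime p → ¬ (p ∣ N) →
    (a : ℕ → ℤ) →
    a 0 ≡ + 1 →
    (∀ m → a (suc (suc m)) ≡ a 1 ℤ.* a (suc m) ℤ.- (+ (p ^ (k ∸ 1))) ℤ.* a m) →
    a 1 ℤ.* a 1 ℤ.≤ + (4 ℕ.* p ^ (k ∸ 1)) →
    (n : ℕ) → n ≥ 1 → (d : ℕ) → d ≥ 1 → d ∣ suc n →
    a n ≢ + 0 →
    P (a n) ≥ P (a (d ∸ 1))
lemma4 _ k p _ _ _ _ a a-0 a-rec _ n _ (suc e) _ d∣1+n a[n]≢0 =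
  P-mono-∣ (a e) (a n) (∣⇒∣ᵤ (shifted-mono-∣ (+ (p ^ (k ∸ 1))) a a-0 a-rec d∣1+n)) a[n]≢0
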